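{- There exists a uniformly recurrent infinite word with bounded Abelian complexity such that there are infinitely many positions $i$ at which no Abelian square occurs (i.e., infinitely many $i$ such that the suffix starting at position $i$ has no prefix that is an Abelian square).
   Context: Two finite words are Abelian equivalent if every letter occurs the same number of times in each. An Abelian square is a word $uv$ with $u,v$ nonempty and Abelian equivalent. The Abelian complexity of an infinite word $\mathbf{x}$ is $n\mapsto$ number of Abelian equivalence classes among its factors of length $n$; bounded means this function is bounded. An infinite word is uniformly recurrent if every factor occurs infinitely often with bounded gaps between consecutive occurrences. -}

module Defs where

open import Data.Nat using (ℕ; zero; suc; _+_; _≤_; _<_)
open import Data.Fin using (Fin; _≟_)
open import Data.Product using (Σ; ∃; _×_; _,_)
open import Relation.Nullary using (¬_; yes; no)
open import Relation.Binary.PropositionalEquality using (_≡_; _≢_)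

Word : ℕ → Set
Word k = ℕ → Fin k

count : ∀ {k} → Fin k → Word k → ℕ → ℕ → ℕ
count a x i zero = 0
count a x i (suc n) with x (i + n) ≟ a
... | yes _ = suc (count a x i n)
... | no  _ = count a x i n

AbEq : ∀ {k} → Word k → ℕ → ℕ → ℕ → Set
AbEq {k} x i j n = (a : Fin k) → count a x i n ≡ count a x j n

FactorEq : ∀ {k} → Word k → ℕ → ℕ → ℕ → Set
FactorEq x i j n = (t : ℕ) → t < n → x (i + t) ≡ x (j + t)

-- Abelian complexity is at most B at length n: among any B+1 factors of
-- length n, two of them (at distinct indices) are Abelian equivalent.
AbComplexity≤ : ∀ {k} → Word k → ℕ → ℕ → Set
AbComplexity≤ x B n =
  (pos : Fin (suc B) → ℕ) →
  Σ (Fin (suc B)) λ p → Σ (Fin (suc B)) λ q → p ≢ q × AbEq x (pos p) (pos q) n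

BoundedAbelianComplexity : ∀ {k} → Word k → Set
BoundedAbelianComplexity x = Σ ℕ λ B → (n : ℕ) → AbComplexity≤ x B n

UniformlyRecurrent : ∀ {k} → Word k → Set
UniformlyRecurrent x =
  (i n : ℕ) → Σ ℕ λ g → (p : ℕ) →
    Σ ℕ λ j → p ≤ j × j ≤ p + g × FactorEq x i j n

NoAbelianSquareAt : ∀ {k} → Word k → ℕ → Set
NoAbelianSquareAt x i = (m : ℕ) → 1 ≤ m → ¬ AbEq x i (i + m) m

InfinitelyManyNoAbSqPositions : ∀ {k} → Word k → Set
InfinitelyManyNoAbSqPositions x = (N : ℕ) → Σ ℕ λ i → N ≤ i × NoAbelianSquareAt x i

-- Colour every q ∈ ℕ by whether its lowest and second lowest nonzero ternary
-- digits equal 2, and let xw be the word over five letters whose q-th block of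
-- five letters is a permutation of the alphabet determined by that colour.
--
-- * Words made of permutation blocks are balanced (letter counts of equal
--   length factors differ by at most 4), and balanced words have bounded
--   Abelian complexity by pigeonhole on letter counts modulo 5.
-- * The colouring is Toeplitz: adding (9t + 4) · 3^E to N < 3^E keeps the
--   colour, so every factor reoccurs along an arithmetic progression, which
--   gives uniform recurrence.
-- * An Abelian square at 5j + 1 yields, block by block, an equation between
--   the colours of j, j + M and j + 2M; a finite check over all colours shows
--   it forces these three colours to be equal. No progression 3^e, 3^e + M,
--   3^e + 2M is monochromatic, since doubling changes the lowest nonzero
--   ternary digit; hence no Abelian square begins at 5 · 3^e + 1.
module Submission where

open import Defs
open import Data.Nat using (ℕ)
open import Data.Product using (Σ; _×_)
open import Data.Nat using (zero; suc; _+_; _*_; _∸_; _^_; _≤_; _<_; NonZero; z≤n; s≤s; _≟_)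
open import Data.Nat.Properties hiding (_≟_)
open import Data.Nat.Induction using (<-rec)
open import Data.Nat.DivMod
  using (_%_; _/_; _mod_; m≡m%n+[m/n]*n; m%n<n; m/n*n≤m; [m+kn]%n≡m%n; +-distrib-/-∣ʳ; m*n/n≡m; m<n⇒m/n≡0; m/n≤m; _divMod_; result)
open import Data.Nat.Tactic.RingSolver using (solve-∀)
open import Data.Fin using (Fin; toℕ; funToFin; finToFun; #_) renaming (_≟_ to _≟ᶠ_)
import Data.Fin as Fin
open import Data.Fin.Properties using (pigeonhole; toℕ-fromℕ<; finToFun-funToFin; fromℕ<-cong; all?; toℕ<n) renaming (<⇒≢ to <⇒≢ᶠ)
open import Data.Product using (_,_; proj₁; proj₂)
open import Data.Empty using (⊥; ⊥-elim)
open import Data.Bool using (Bool; true; false)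
import Data.Bool.Properties as Bool
open import Data.Product.Properties using (≡-dec)
open import Data.Unit using (tt)
open import Data.List using (List; []; _∷_)
open import Data.Vec using (Vec; []; _∷_)
import Data.Vec as Vec
open import Data.Nat.Divisibility using (divides)
open import Relation.Nullary using (Dec; yes; no)
open import Relation.Nullary.Decidable using (map′; _×-dec_; _→-dec_; toWitness)
open import Relation.Binary.Definitions using (tri<; tri≈; tri>)
open import Relation.Binary.PropositionalEquality

private
  variable
    k : ℕ

occ : Fin k → Fin k → ℕ
occ a b with b ≟ᶠ a
... | yes _ = 1
... | no  _ = 0

count-suc : (a : Fin k) (x : Word k) (i n : ℕ) →
            count a x i (suc n) ≡ occ a (x (i + n)) + count a x i n
count-suc a x i n with x (i + n) ≟ᶠ a
... | yes _ = refl
... | no  _ = refl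

count-+ : (a : Fin k) (x : Word k) (i n m : ℕ) →
          count a x i (n + m) ≡ count a x i n + count a x (i + n) m
count-+ a x i n zero rewrite +-identityʳ n = sym (+-identityʳ _)
count-+ a x i n (suc m) = begin
  count a x i (n + suc m)                           ≡⟨ cong (count a x i) (+-suc n m) ⟩
  count a x i (suc (n + m))                         ≡⟨ count-suc a x i (n + m) ⟩
  occ a (x (i + (n + m))) + count a x i (n + m)     ≡⟨ cong₂ (λ p c → occ a (x p) + c) (sym (+-assoc i n m)) (count-+ a x i n m) ⟩
  occ a (x (i + n + m)) + (count a x i n + count a x (i + n) m)
    ≡⟨ x+[y+z]≡y+[x+z] (occ a (x (i + n + m))) (count a x i n) _ ⟩
  count a x i n + (occ a (x (i + n + m)) + count a x (i + n) m)
    ≡⟨ cong (count a x i n +_) (sym (count-suc a x (i + n) m)) ⟩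
  count a x i n + count a x (i + n) (suc m)         ∎
  where
  open ≡-Reasoning
  x+[y+z]≡y+[x+z] : ∀ p q r → p + (q + r) ≡ q + (p + r)
  x+[y+z]≡y+[x+z] = solve-∀

count-mono : (a : Fin k) (x : Word k) (i n d : ℕ) → count a x i n ≤ count a x i (n + d)
count-mono a x i n d rewrite count-+ a x i n d = m≤m+n _ _

count-cong : (a : Fin k) (x y : Word k) (i j n : ℕ) →
             (∀ t → t < n → x (i + t) ≡ y (j + t)) → count a x i n ≡ count a y j n
count-cong a x y i j zero    same = refl
count-cong a x y i j (suc n) same = begin
  count a x i (suc n)                        ≡⟨ count-suc a x i n ⟩
  occ a (x (i + n)) + count a x i n          ≡⟨ cong₂ _+_ (cong (occ a) (same n ≤-refl)) shorter ⟩
  occ a (y (j + n)) + count a y j n          ≡⟨ sym (count-suc a y j n) ⟩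
  count a y j (suc n)                        ∎
  where
  open ≡-Reasoning
  shorter : count a x i n ≡ count a y j n
  shorter = count-cong a x y i j n (λ t t<n → same t (m<n⇒m<1+n t<n))

square-prefixCounts : (a : Fin k) (x : Word k) (i d m : ℕ) → AbEq x (i + d) (i + d + m) m →
  count a x i (d + m + m) + count a x i d ≡ count a x i (d + m) + count a x i (d + m)
square-prefixCounts a x i d m square = begin
  count a x i (d + m + m) + P                       ≡⟨ cong (_+ P) (count-+ a x i (d + m) m) ⟩
  count a x i (d + m) + count a x (i + (d + m)) m + P
    ≡⟨ cong (λ p → count a x i (d + m) + count a x p m + P) (sym (+-assoc i d m)) ⟩
  count a x i (d + m) + V + P                       ≡⟨ cong (λ c → count a x i (d + m) + c + P) (sym (square a)) ⟩
  count a x i (d + m) + U + P                       ≡⟨ +-assoc (count a x i (d + m)) U P ⟩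
  count a x i (d + m) + (U + P)                     ≡⟨ cong (count a x i (d + m) +_) (+-comm U P) ⟩
  count a x i (d + m) + (P + U)                     ≡⟨ cong (count a x i (d + m) +_) (sym (count-+ a x i d m)) ⟩
  count a x i (d + m) + count a x i (d + m)         ∎
  where
  open ≡-Reasoning
  P : ℕ
  P = count a x i d
  U : ℕ
  U = count a x (i + d) m
  V : ℕ
  V = count a x (i + d + m) m

Balanced : ℕ → Word k → Set
Balanced {k} b x = (a : Fin k) (i j n : ℕ) → count a x i n < count a x j n + b

congruent-gap : ∀ b .{{_ : NonZero b}} m n → m % b ≡ n % b → m / b < n / b → m + b ≤ n
congruent-gap b m n same-rem quot< = begin
  m + b                      ≡⟨ cong (_+ b) (m≡m%n+[m/n]*n m b) ⟩
  m % b + m / b * b + b      ≡⟨ cong (λ r → r + m / b * b + b) same-rem ⟩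
  n % b + m / b * b + b      ≡⟨ +-assoc (n % b) (m / b * b) b ⟩
  n % b + (m / b * b + b)    ≡⟨ cong (n % b +_) (+-comm (m / b * b) b) ⟩
  n % b + suc (m / b) * b    ≤⟨ +-monoʳ-≤ (n % b) (*-monoˡ-≤ b quot<) ⟩
  n % b + n / b * b          ≡⟨ sym (m≡m%n+[m/n]*n n b) ⟩
  n                          ∎
  where open ≤-Reasoning

congruent-close⇒equal : ∀ b .{{_ : NonZero b}} m n → m % b ≡ n % b → m < n + b → n < m + b → m ≡ n
congruent-close⇒equal b m n same-rem m<n+b n<m+b with <-cmp (m / b) (n / b)
... | tri< quot< _ _ = ⊥-elim (<⇒≱ n<m+b (congruent-gap b m n same-rem quot<))
... | tri> _ _ quot> = ⊥-elim (<⇒≱ m<n+b (congruent-gap b n m (sym same-rem) quot>))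
... | tri≈ _ same-quot _ = begin
  m                  ≡⟨ m≡m%n+[m/n]*n m b ⟩
  m % b + m / b * b  ≡⟨ cong₂ (λ r q → r + q * b) same-rem same-quot ⟩
  n % b + n / b * b  ≡⟨ sym (m≡m%n+[m/n]*n n b) ⟩
  n                  ∎
  where open ≡-Reasoning

-- In a b-balanced word the counts of a factor modulo b determine its Abelian
-- class, so there are at most b ^ k classes (pigeonhole on the encoding of
-- the residue vector as an element of Fin (b ^ k)).
balanced⇒boundedAbelianComplexity : ∀ b .{{_ : NonZero b}} (x : Word k) →
  Balanced b x → BoundedAbelianComplexity x
balanced⇒boundedAbelianComplexity {k} b x balanced = b ^ k , classesAtMost
  where
  residues : ℕ → ℕ → Fin k → Fin b
  residues n i a = count a x i n mod b

  same-residues⇒AbEq : ∀ n i j → funToFin (residues n i) ≡ funToFin (residues n j) → AbEq x i j n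
  same-residues⇒AbEq n i j same a = congruent-close⇒equal b _ _ same-rem
      (balanced a i j n) (balanced a j i n)
    where
    same-rem : count a x i n % b ≡ count a x j n % b
    same-rem = begin
      count a x i n % b                   ≡⟨ sym (toℕ-fromℕ< _) ⟩
      toℕ (residues n i a)                ≡⟨ cong toℕ (sym (finToFun-funToFin (residues n i) a)) ⟩
      toℕ (finToFun (funToFin (residues n i)) a) ≡⟨ cong (λ c → toℕ (finToFun c a)) same ⟩
      toℕ (finToFun (funToFin (residues n j)) a) ≡⟨ cong toℕ (finToFun-funToFin (residues n j) a) ⟩
      toℕ (residues n j a)                ≡⟨ toℕ-fromℕ< _ ⟩
      count a x j n % b                   ∎
      where open ≡-Reasoning

  classesAtMost : (n : ℕ) → AbComplexity≤ x (b ^ k) n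
  classesAtMost n pos with pigeonhole (n<1+n (b ^ k)) (λ p → funToFin (residues n (pos p)))
  ... | p , q , p<q , same = p , q , <⇒≢ᶠ p<q , same-residues⇒AbEq n (pos p) (pos q) same

PermutationBlocks : Word k → Set
PermutationBlocks {k} x = (a : Fin k) (q : ℕ) → count a x (q * k) k ≡ 1

module PermutationBlockCounts {k} .{{_ : NonZero k}} (x : Word k) (perm : PermutationBlocks x) (a : Fin k) where

  blocks-count : ∀ q M → count a x (q * k) (M * k) ≡ M
  blocks-count q zero = refl
  blocks-count q (suc M) = begin
    count a x (q * k) (k + M * k)                    ≡⟨ count-+ a x (q * k) k (M * k) ⟩
    count a x (q * k) k + count a x (q * k + k) (M * k)
      ≡⟨ cong₂ (λ c p → c + count a x p (M * k)) (perm a q) (+-comm (q * k) k) ⟩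
    suc (count a x (suc q * k) (M * k))              ≡⟨ cong suc (blocks-count (suc q) M) ⟩
    suc M                                            ∎
    where open ≡-Reasoning

  window : ∀ q M t → count a x (q * k) (M * k + t) ≡ M + count a x ((q + M) * k) t
  window q M t = begin
    count a x (q * k) (M * k + t)                         ≡⟨ count-+ a x (q * k) (M * k) t ⟩
    count a x (q * k) (M * k) + count a x (q * k + M * k) t
      ≡⟨ cong₂ (λ c p → c + count a x p t) (blocks-count q M) (sym (*-distribʳ-+ k q M)) ⟩
    M + count a x ((q + M) * k) t                         ∎
    where open ≡-Reasoning

  partial-block : ∀ q t → t ≤ k → count a x (q * k) t ≤ 1
  partial-block q t t≤k = begin
    count a x (q * k) t            ≤⟨ count-mono a x (q * k) t (k ∸ t) ⟩
    count a x (q * k) (t + (k ∸ t)) ≡⟨ cong (count a x (q * k)) (m+[n∸m]≡n t≤k) ⟩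
    count a x (q * k) k            ≡⟨ perm a q ⟩
    1                              ∎
    where open ≤-Reasoning

  prefix-bounds : ∀ N → k * count a x 0 N ≤ N + k × N ≤ k * count a x 0 N + k
  prefix-bounds N = upper , lower
    where
    q : ℕ
    q = N / k
    r : ℕ
    r = N % k
    c : ℕ
    c = count a x (q * k) r
    N≡ : N ≡ q * k + r
    N≡ = trans (m≡m%n+[m/n]*n N k) (+-comm r (q * k))
    prefix : count a x 0 N ≡ q + c
    prefix = trans (cong (count a x 0) N≡) (window 0 q r)
    c≤1 : c ≤ 1
    c≤1 = partial-block q r (<⇒≤ (m%n<n N k))
    upper : k * count a x 0 N ≤ N + k
    upper = begin
      k * count a x 0 N  ≡⟨ cong (k *_) prefix ⟩
      k * (q + c)        ≡⟨ *-distribˡ-+ k q c ⟩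
      k * q + k * c      ≤⟨ +-mono-≤ (≤-reflexive (*-comm k q)) (*-monoʳ-≤ k c≤1) ⟩
      q * k + k * 1      ≤⟨ +-mono-≤ (m/n*n≤m N k) (≤-reflexive (*-identityʳ k)) ⟩
      N + k              ∎
      where open ≤-Reasoning
    lower : N ≤ k * count a x 0 N + k
    lower = begin
      N                  ≡⟨ N≡ ⟩
      q * k + r          ≤⟨ +-mono-≤ (≤-reflexive (*-comm q k)) (<⇒≤ (m%n<n N k)) ⟩
      k * q + k          ≤⟨ +-monoˡ-≤ k (*-monoʳ-≤ k (m≤m+n q c)) ⟩
      k * (q + c) + k    ≡⟨ cong (λ p → k * p + k) (sym prefix) ⟩
      k * count a x 0 N + k ∎
      where open ≤-Reasoning

  factor-bounds : ∀ i n → k * count a x i n ≤ n + 2 * k × n ≤ k * count a x i n + 2 * k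
  factor-bounds i n = +-cancelˡ-≤ i _ _ upper , +-cancelˡ-≤ i _ _ lower
    where
    c : ℕ
    c = count a x i n
    split : count a x 0 (i + n) ≡ count a x 0 i + c
    split = count-+ a x 0 i n
    upper : i + k * c ≤ i + (n + 2 * k)
    upper = begin
      i + k * c                            ≤⟨ +-monoˡ-≤ (k * c) (proj₂ (prefix-bounds i)) ⟩
      k * count a x 0 i + k + k * c        ≡⟨ rearrange k (count a x 0 i) c ⟩
      k * (count a x 0 i + c) + k          ≡⟨ cong (λ p → k * p + k) (sym split) ⟩
      k * count a x 0 (i + n) + k          ≤⟨ +-monoˡ-≤ k (proj₁ (prefix-bounds (i + n))) ⟩
      i + n + k + k                        ≡⟨ regroup k i n ⟩
      i + (n + 2 * k)                      ∎
      where
      open ≤-Reasoning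
      rearrange : ∀ k p c → k * p + k + k * c ≡ k * (p + c) + k
      rearrange = solve-∀
      regroup : ∀ k i n → i + n + k + k ≡ i + (n + 2 * k)
      regroup = solve-∀
    lower : i + n ≤ i + (k * c + 2 * k)
    lower = begin
      i + n                                ≤⟨ proj₂ (prefix-bounds (i + n)) ⟩
      k * count a x 0 (i + n) + k          ≡⟨ cong (λ p → k * p + k) split ⟩
      k * (count a x 0 i + c) + k          ≡⟨ rearrange k (count a x 0 i) c ⟩
      k * count a x 0 i + (k * c + k)      ≤⟨ +-monoˡ-≤ (k * c + k) (proj₁ (prefix-bounds i)) ⟩
      i + k + (k * c + k)                  ≡⟨ regroup k i c ⟩
      i + (k * c + 2 * k)                  ∎
      where
      open ≤-Reasoning
      rearrange : ∀ k p c → k * (p + c) + k ≡ k * p + (k * c + k)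
      rearrange = solve-∀
      regroup : ∀ k i c → i + k + (k * c + k) ≡ i + (k * c + 2 * k)
      regroup = solve-∀

permutationBlocks⇒balanced : .{{_ : NonZero k}} (x : Word k) → PermutationBlocks x → Balanced 5 x
permutationBlocks⇒balanced {k} x perm a i j n =
  ≤-trans (s≤s (*-cancelˡ-≤ k differ≤4)) (≤-reflexive (sym (+-suc (count a x j n) 4)))
  where
  open PermutationBlockCounts x perm a
  differ≤4 : k * count a x i n ≤ k * (count a x j n + 4)
  differ≤4 = begin
    k * count a x i n                   ≤⟨ proj₁ (factor-bounds i n) ⟩
    n + 2 * k                           ≤⟨ +-monoˡ-≤ (2 * k) (proj₂ (factor-bounds j n)) ⟩
    k * count a x j n + 2 * k + 2 * k   ≡⟨ collect k (count a x j n) ⟩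
    k * (count a x j n + 4)             ∎
    where
    open ≤-Reasoning
    collect : ∀ k c → k * c + 2 * k + 2 * k ≡ k * (c + 4)
    collect = solve-∀

progression-meets-window : ∀ A L .{{_ : NonZero L}} p →
  Σ ℕ λ t → p ≤ A + t * L × A + t * L ≤ p + (A + L)
progression-meets-window A L p = suc (p / L) , lower , upper
  where
  q : ℕ
  q = p / L
  lower : p ≤ A + suc q * L
  lower = begin
    p                 ≡⟨ trans (m≡m%n+[m/n]*n p L) (+-comm (p % L) (q * L)) ⟩
    q * L + p % L     ≤⟨ +-monoʳ-≤ (q * L) (<⇒≤ (m%n<n p L)) ⟩
    q * L + L         ≡⟨ +-comm (q * L) L ⟩
    suc q * L         ≤⟨ m≤n+m (suc q * L) A ⟩
    A + suc q * L     ∎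
    where open ≤-Reasoning
  upper : A + suc q * L ≤ p + (A + L)
  upper = begin
    A + (L + q * L)   ≡⟨ rotate A L (q * L) ⟩
    q * L + (A + L)   ≤⟨ +-monoˡ-≤ (A + L) (m/n*n≤m p L) ⟩
    p + (A + L)       ∎
    where
    open ≤-Reasoning
    rotate : ∀ A L Q → A + (L + Q) ≡ Q + (A + L)
    rotate = solve-∀

RecurrentAlongProgressions : Word k → Set
RecurrentAlongProgressions x = (i n : ℕ) →
  Σ ℕ λ A → Σ ℕ λ L → NonZero L × ((t : ℕ) → FactorEq x i (A + t * L) n)

recurrentAlongProgressions⇒uniformlyRecurrent : (x : Word k) →
  RecurrentAlongProgressions x → UniformlyRecurrent x
recurrentAlongProgressions⇒uniformlyRecurrent x recurrent i n
  with recurrent i n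
... | A , L , L≢0 , occurrence = A + L , occurrenceNear
  where
  instance _ = L≢0
  occurrenceNear : (p : ℕ) → Σ ℕ λ j → p ≤ j × j ≤ p + (A + L) × FactorEq x i j n
  occurrenceNear p with progression-meets-window A L p
  ... | t , p≤j , j≤p+g = A + t * L , p≤j , j≤p+g , occurrence t

-- Ternary digits, least significant first.
data Trit : Set where
  t0 t1 t2 : Trit

increment : List Trit → List Trit
increment []        = t1 ∷ []
increment (t0 ∷ ds) = t1 ∷ ds
increment (t1 ∷ ds) = t2 ∷ ds
increment (t2 ∷ ds) = t0 ∷ increment ds

ternary : ℕ → List Trit
ternary zero    = []
ternary (suc n) = increment (ternary n)

-- Multiplication by 3 on representations without trailing zeros.
times3 : List Trit → List Trit
times3 []       = []
times3 (d ∷ ds) = t0 ∷ d ∷ ds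

lowestIsTwo : List Trit → Bool
lowestIsTwo []        = false
lowestIsTwo (t0 ∷ ds) = lowestIsTwo ds
lowestIsTwo (t1 ∷ _)  = false
lowestIsTwo (t2 ∷ _)  = true

aboveLowest : List Trit → List Trit
aboveLowest []        = []
aboveLowest (t0 ∷ ds) = aboveLowest ds
aboveLowest (t1 ∷ ds) = ds
aboveLowest (t2 ∷ ds) = ds

Colour : Set
Colour = Bool × Bool

true≢false : true ≢ false
true≢false ()

-- Only the recurrences colour-0 … colour-3q+2 below are used afterwards, so
-- the definition is kept opaque.
opaque
  colour : ℕ → Colour
  colour n = lowestIsTwo (ternary n) , lowestIsTwo (aboveLowest (ternary n))

lowDigitTwo : ℕ → Bool
lowDigitTwo n = proj₁ (colour n)

ternary-3q : ∀ q → ternary (q * 3) ≡ times3 (ternary q)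
ternary-3q zero    = refl
ternary-3q (suc q) = trans (cong (λ ds → increment (increment (increment ds))) (ternary-3q q))
                           (increment³-times3 (ternary q))
  where
  increment³-times3 : ∀ ds → increment (increment (increment (times3 ds))) ≡ times3 (increment ds)
  increment³-times3 []        = refl
  increment³-times3 (t0 ∷ ds) = refl
  increment³-times3 (t1 ∷ ds) = refl
  increment³-times3 (t2 ∷ ds) = refl

ternary-3q+1 : ∀ q → ternary (suc (q * 3)) ≡ t1 ∷ ternary q
ternary-3q+1 q = trans (cong increment (ternary-3q q)) (increment-times3 (ternary q))
  where
  increment-times3 : ∀ ds → increment (times3 ds) ≡ t1 ∷ ds
  increment-times3 []      = refl
  increment-times3 (_ ∷ _) = refl

opaque
  unfolding colour

  colour-0 : colour 0 ≡ (false , false)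
  colour-0 = refl

  colour-3q : ∀ q → colour (q * 3) ≡ colour q
  colour-3q q rewrite ternary-3q q = colour-times3 (ternary q)
    where
    colour-times3 : ∀ ds → (lowestIsTwo (times3 ds) , lowestIsTwo (aboveLowest (times3 ds)))
                         ≡ (lowestIsTwo ds , lowestIsTwo (aboveLowest ds))
    colour-times3 []      = refl
    colour-times3 (_ ∷ _) = refl

  colour-3q+1 : ∀ q → colour (suc (q * 3)) ≡ (false , lowDigitTwo q)
  colour-3q+1 q rewrite ternary-3q+1 q = refl

  colour-3q+2 : ∀ q → colour (suc (suc (q * 3))) ≡ (true , lowDigitTwo q)
  colour-3q+2 q rewrite ternary-3q+1 q = refl

data Mod3 : ℕ → Set where
  3q   : ∀ q → Mod3 (q * 3)
  3q+1 : ∀ q → Mod3 (suc (q * 3))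
  3q+2 : ∀ q → Mod3 (suc (suc (q * 3)))

mod3 : ∀ n → Mod3 n
mod3 zero = 3q 0
mod3 (suc n) with mod3 n
... | 3q q   = 3q+1 q
... | 3q+1 q = 3q+2 q
... | 3q+2 q = 3q (suc q)

lowDigitTwo-3q : ∀ q → lowDigitTwo (q * 3) ≡ lowDigitTwo q
lowDigitTwo-3q q = cong proj₁ (colour-3q q)

lowDigitTwo-3q+1 : ∀ q → lowDigitTwo (suc (q * 3)) ≡ false
lowDigitTwo-3q+1 q = cong proj₁ (colour-3q+1 q)

lowDigitTwo-3q+2 : ∀ q → lowDigitTwo (suc (suc (q * 3))) ≡ true
lowDigitTwo-3q+2 q = cong proj₁ (colour-3q+2 q)

-- Doubling changes the lowest nonzero ternary digit: 1 becomes 2, and 2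
-- becomes 1 (with a carry), while trailing zeros are kept.
lowDigitTwo-double : ∀ M → 1 ≤ M → lowDigitTwo (M + M) ≢ lowDigitTwo M
lowDigitTwo-double = <-rec _ double
  where
  double : ∀ M → (∀ {M′} → M′ < M → 1 ≤ M′ → lowDigitTwo (M′ + M′) ≢ lowDigitTwo M′) →
           1 ≤ M → lowDigitTwo (M + M) ≢ lowDigitTwo M
  double M smaller 1≤M with mod3 M
  ... | 3q zero    = ⊥-elim (<⇒≱ 1≤M z≤n)
  ... | 3q (suc q) = λ same → smaller (m<m*n (suc q) 3 (s≤s (s≤s z≤n))) (s≤s z≤n) (begin
    lowDigitTwo (suc q + suc q)               ≡⟨ sym (lowDigitTwo-3q (suc q + suc q)) ⟩
    lowDigitTwo ((suc q + suc q) * 3)         ≡⟨ cong lowDigitTwo (*-distribʳ-+ 3 (suc q) (suc q)) ⟩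
    lowDigitTwo (suc q * 3 + suc q * 3)       ≡⟨ same ⟩
    lowDigitTwo (suc q * 3)                   ≡⟨ lowDigitTwo-3q (suc q) ⟩
    lowDigitTwo (suc q)                       ∎)
    where open ≡-Reasoning
  ... | 3q+1 q = λ same → true≢false (begin
    true                                      ≡⟨ sym (lowDigitTwo-3q+2 (q + q)) ⟩
    lowDigitTwo (suc (suc ((q + q) * 3)))     ≡⟨ cong lowDigitTwo (sym (doubled q)) ⟩
    lowDigitTwo (suc (q * 3) + suc (q * 3))   ≡⟨ same ⟩
    lowDigitTwo (suc (q * 3))                 ≡⟨ lowDigitTwo-3q+1 q ⟩
    false                                     ∎)
    where
    open ≡-Reasoning
    doubled : ∀ q → suc (q * 3) + suc (q * 3) ≡ suc (suc ((q + q) * 3))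
    doubled = solve-∀
  ... | 3q+2 q = λ same → true≢false (begin
    true                                      ≡⟨ sym (lowDigitTwo-3q+2 q) ⟩
    lowDigitTwo (suc (suc (q * 3)))           ≡⟨ sym same ⟩
    lowDigitTwo (suc (suc (q * 3)) + suc (suc (q * 3))) ≡⟨ cong lowDigitTwo (doubled q) ⟩
    lowDigitTwo (suc (suc (q + q) * 3))       ≡⟨ lowDigitTwo-3q+1 (suc (q + q)) ⟩
    false                                     ∎)
    where
    open ≡-Reasoning
    doubled : ∀ q → suc (suc (q * 3)) + suc (suc (q * 3)) ≡ suc (suc (q + q) * 3)
    doubled = solve-∀

StartsNoMonochromaticAP : ℕ → Set
StartsNoMonochromaticAP j =
  ∀ M → 1 ≤ M → colour (j + M) ≡ colour j → colour (j + (M + M)) ≡ colour j → ⊥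

colour-≢ : ∀ {m n} → lowDigitTwo m ≢ lowDigitTwo n → colour m ≢ colour n
colour-≢ differ same = differ (cong proj₁ same)

-- For j = 1: if M = 3q, the colours of 1 + M and 1 + 2M record the lowest
-- digits of q and 2q, which differ; otherwise 1 + M or 1 + 2M has lowest digit 2.
startsNoMonochromaticAP-1 : StartsNoMonochromaticAP 1
startsNoMonochromaticAP-1 M 1≤M same₁ same₂ with mod3 M
... | 3q zero     = <⇒≱ 1≤M z≤n
... | 3q (suc q)  = lowDigitTwo-double (suc q) (s≤s z≤n) (begin
  lowDigitTwo (suc q + suc q)     ≡⟨ cong proj₂ (sym (colour-3q+1 (suc q + suc q))) ⟩
  proj₂ (colour (suc ((suc q + suc q) * 3)))
    ≡⟨ cong (λ n → proj₂ (colour (suc n))) (*-distribʳ-+ 3 (suc q) (suc q)) ⟩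
  proj₂ (colour (1 + (suc q * 3 + suc q * 3)))  ≡⟨ cong proj₂ (trans same₂ (sym same₁)) ⟩
  proj₂ (colour (1 + suc q * 3))  ≡⟨ cong proj₂ (colour-3q+1 (suc q)) ⟩
  lowDigitTwo (suc q)             ∎)
  where open ≡-Reasoning
... | 3q+1 q = colour-≢ (λ e → true≢false (trans (sym (lowDigitTwo-3q+2 q)) (trans e (lowDigitTwo-3q+1 0))))
                        same₁
... | 3q+2 q = colour-≢ (λ e → true≢false (trans (sym (lowDigitTwo-3q+2 (suc (q + q))))
                                  (trans (cong lowDigitTwo (sym (doubled q))) (trans e (lowDigitTwo-3q+1 0)))))
                        same₂
  where
  doubled : ∀ q → 1 + (suc (suc (q * 3)) + suc (suc (q * 3))) ≡ suc (suc (suc (q + q) * 3))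
  doubled = solve-∀

-- Multiplying by 3 preserves the property: for M divisible by 3 the
-- progression is the scaled image of one starting at j, and otherwise j·3 + M
-- and j·3 + 2M have different lowest digits.
startsNoMonochromaticAP-3* : ∀ j → StartsNoMonochromaticAP j → StartsNoMonochromaticAP (j * 3)
startsNoMonochromaticAP-3* j noAP M 1≤M same₁ same₂ with mod3 M
... | 3q zero    = <⇒≱ 1≤M z≤n
... | 3q (suc q) = noAP (suc q) (s≤s z≤n) (descend (suc q) same₁) (descend (suc q + suc q) shifted₂)
  where
  descend : ∀ n → colour (j * 3 + n * 3) ≡ colour (j * 3) → colour (j + n) ≡ colour j
  descend n same = begin
    colour (j + n)            ≡⟨ sym (colour-3q (j + n)) ⟩
    colour ((j + n) * 3)      ≡⟨ cong colour (*-distribʳ-+ 3 j n) ⟩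
    colour (j * 3 + n * 3)    ≡⟨ same ⟩
    colour (j * 3)            ≡⟨ colour-3q j ⟩
    colour j                  ∎
    where open ≡-Reasoning
  shifted₂ : colour (j * 3 + (suc q + suc q) * 3) ≡ colour (j * 3)
  shifted₂ = trans (cong (λ n → colour (j * 3 + n)) (*-distribʳ-+ 3 (suc q) (suc q))) same₂
... | 3q+1 q = colour-≢ differ (trans same₁ (sym same₂))
  where
  differ : lowDigitTwo (j * 3 + suc (q * 3)) ≢ lowDigitTwo (j * 3 + (suc (q * 3) + suc (q * 3)))
  differ e = true≢false (begin
    true                                            ≡⟨ sym (lowDigitTwo-3q+2 (j + (q + q))) ⟩
    lowDigitTwo (suc (suc ((j + (q + q)) * 3)))     ≡⟨ cong lowDigitTwo (sym (arith j q)) ⟩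
    lowDigitTwo (j * 3 + (suc (q * 3) + suc (q * 3))) ≡⟨ sym e ⟩
    lowDigitTwo (j * 3 + suc (q * 3))               ≡⟨ cong lowDigitTwo (+-suc (j * 3) (q * 3)) ⟩
    lowDigitTwo (suc (j * 3 + q * 3))               ≡⟨ cong (λ n → lowDigitTwo (suc n)) (sym (*-distribʳ-+ 3 j q)) ⟩
    lowDigitTwo (suc ((j + q) * 3))                 ≡⟨ lowDigitTwo-3q+1 (j + q) ⟩
    false                                           ∎)
    where
    open ≡-Reasoning
    arith : ∀ j q → j * 3 + (suc (q * 3) + suc (q * 3)) ≡ suc (suc ((j + (q + q)) * 3))
    arith = solve-∀
... | 3q+2 q = colour-≢ differ (trans same₁ (sym same₂))
  where
  differ : lowDigitTwo (j * 3 + suc (suc (q * 3))) ≢ lowDigitTwo (j * 3 + (suc (suc (q * 3)) + suc (suc (q * 3))))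
  differ e = true≢false (begin
    true                                            ≡⟨ sym (lowDigitTwo-3q+2 (j + q)) ⟩
    lowDigitTwo (suc (suc ((j + q) * 3)))           ≡⟨ cong lowDigitTwo (sym (arith₁ j q)) ⟩
    lowDigitTwo (j * 3 + suc (suc (q * 3)))         ≡⟨ e ⟩
    lowDigitTwo (j * 3 + (suc (suc (q * 3)) + suc (suc (q * 3)))) ≡⟨ cong lowDigitTwo (arith₂ j q) ⟩
    lowDigitTwo (suc (suc (j + (q + q)) * 3))       ≡⟨ lowDigitTwo-3q+1 (suc (j + (q + q))) ⟩
    false                                           ∎)
    where
    open ≡-Reasoning
    arith₁ : ∀ j q → j * 3 + suc (suc (q * 3)) ≡ suc (suc ((j + q) * 3))
    arith₁ = solve-∀
    arith₂ : ∀ j q → j * 3 + (suc (suc (q * 3)) + suc (suc (q * 3))) ≡ suc (suc (j + (q + q)) * 3)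
    arith₂ = solve-∀

startsNoMonochromaticAP-3^ : ∀ e → StartsNoMonochromaticAP (3 ^ e)
startsNoMonochromaticAP-3^ zero    = startsNoMonochromaticAP-1
startsNoMonochromaticAP-3^ (suc e) =
  subst StartsNoMonochromaticAP (*-comm (3 ^ e) 3) (startsNoMonochromaticAP-3* (3 ^ e) (startsNoMonochromaticAP-3^ e))

-- Toeplitz structure of the colouring: if the two lowest nonzero digits of s
-- are 1, adding s · 3^E to N < 3^E does not change the colour of N.
colour-periodic : ∀ s → colour s ≡ (false , false) → ∀ E N → N < 3 ^ E →
                  colour (N + s * 3 ^ E) ≡ colour N
colour-periodic s s-colour zero zero _ = trans (cong colour (*-identityʳ s)) (trans s-colour (sym colour-0))
colour-periodic s s-colour zero (suc N) (s≤s ())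
colour-periodic s s-colour (suc E) N N<3^E+1 = by-last-digit (mod3 N) N<3^E+1
  where
  p : ℕ
  p = 3 ^ E
  shift : ∀ r q s p → r + q * 3 + s * (3 * p) ≡ r + (q + s * p) * 3
  shift = solve-∀
  above : ∀ r q → r + q * 3 < 3 * p → colour (q + s * p) ≡ colour q
  above r q N<3p = colour-periodic s s-colour E q
    (*-cancelʳ-< 3 q p (≤-<-trans (m≤n+m (q * 3) r) (<-≤-trans N<3p (≤-reflexive (*-comm 3 p)))))
  by-last-digit : ∀ {N} → Mod3 N → N < 3 * p → colour (N + s * (3 * p)) ≡ colour N
  by-last-digit (3q q) N<3p = begin
    colour (q * 3 + s * (3 * p))          ≡⟨ cong colour (shift 0 q s p) ⟩
    colour ((q + s * p) * 3)              ≡⟨ colour-3q (q + s * p) ⟩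
    colour (q + s * p)                    ≡⟨ above 0 q N<3p ⟩
    colour q                              ≡⟨ sym (colour-3q q) ⟩
    colour (q * 3)                        ∎
    where open ≡-Reasoning
  by-last-digit (3q+1 q) N<3p = begin
    colour (1 + q * 3 + s * (3 * p))      ≡⟨ cong colour (shift 1 q s p) ⟩
    colour (suc ((q + s * p) * 3))        ≡⟨ colour-3q+1 (q + s * p) ⟩
    (false , lowDigitTwo (q + s * p))     ≡⟨ cong (λ c → false , proj₁ c) (above 1 q N<3p) ⟩
    (false , lowDigitTwo q)               ≡⟨ sym (colour-3q+1 q) ⟩
    colour (suc (q * 3))                  ∎
    where open ≡-Reasoning
  by-last-digit (3q+2 q) N<3p = begin
    colour (2 + q * 3 + s * (3 * p))      ≡⟨ cong colour (shift 2 q s p) ⟩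
    colour (suc (suc ((q + s * p) * 3)))  ≡⟨ colour-3q+2 (q + s * p) ⟩
    (true , lowDigitTwo (q + s * p))      ≡⟨ cong (λ c → true , proj₁ c) (above 2 q N<3p) ⟩
    (true , lowDigitTwo q)                ≡⟨ sym (colour-3q+2 q) ⟩
    colour (suc (suc (q * 3)))            ∎
    where open ≡-Reasoning

blockLetters : Colour → Vec (Fin 5) 5
blockLetters (false , false) = # 0 ∷ # 1 ∷ # 2 ∷ # 3 ∷ # 4 ∷ []
blockLetters (false , true)  = # 1 ∷ # 0 ∷ # 2 ∷ # 3 ∷ # 4 ∷ []
blockLetters (true  , false) = # 2 ∷ # 0 ∷ # 1 ∷ # 3 ∷ # 4 ∷ []
blockLetters (true  , true)  = # 3 ∷ # 0 ∷ # 1 ∷ # 2 ∷ # 4 ∷ []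

blockWord : Colour → Word 5
blockWord c n = Vec.lookup (blockLetters c) (n mod 5)

xw : Word 5
xw n = blockWord (colour (n / 5)) n

inBlock : Colour → Fin 5 → ℕ → ℕ
inBlock c a t = count a (blockWord c) 0 t

blockWord-periodic : ∀ c n K → blockWord c (n + K * 5) ≡ blockWord c n
blockWord-periodic c n K =
  cong (Vec.lookup (blockLetters c)) (fromℕ<-cong _ _ ([m+kn]%n≡m%n n K 5) (m%n<n (n + K * 5) 5) (m%n<n n 5))

xw-shift : ∀ n K → xw (n + K * 5) ≡ blockWord (colour (n / 5 + K)) n
xw-shift n K = begin
  blockWord (colour ((n + K * 5) / 5)) (n + K * 5)  ≡⟨ cong (λ q → blockWord (colour q) (n + K * 5)) quotient ⟩
  blockWord (colour (n / 5 + K)) (n + K * 5)        ≡⟨ blockWord-periodic (colour (n / 5 + K)) n K ⟩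
  blockWord (colour (n / 5 + K)) n                  ∎
  where
  open ≡-Reasoning
  quotient : (n + K * 5) / 5 ≡ n / 5 + K
  quotient = trans (+-distrib-/-∣ʳ n (divides K refl)) (cong (n / 5 +_) (m*n/n≡m K 5))

xw-block : ∀ a q t → t ≤ 5 → count a xw (q * 5) t ≡ inBlock (colour q) a t
xw-block a q t t≤5 = count-cong a xw (blockWord (colour q)) (q * 5) 0 t inside
  where
  inside : ∀ t′ → t′ < t → xw (q * 5 + t′) ≡ blockWord (colour q) t′
  inside t′ t′<t = begin
    xw (q * 5 + t′)                    ≡⟨ cong xw (+-comm (q * 5) t′) ⟩
    xw (t′ + q * 5)                    ≡⟨ xw-shift t′ q ⟩
    blockWord (colour (t′ / 5 + q)) t′ ≡⟨ cong (λ p → blockWord (colour (p + q)) t′) (m<n⇒m/n≡0 (<-≤-trans t′<t t≤5)) ⟩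
    blockWord (colour q) t′            ∎
    where open ≡-Reasoning

∀-Bool? : {P : Bool → Set} → ((b : Bool) → Dec (P b)) → Dec ((b : Bool) → P b)
∀-Bool? P? = map′ (λ (f , t) → λ { false → f ; true → t }) (λ h → h false , h true) (P? false ×-dec P? true)

∀-Colour? : {P : Colour → Set} → ((c : Colour) → Dec (P c)) → Dec ((c : Colour) → P c)
∀-Colour? P? = map′ (λ h (b₁ , b₂) → h b₁ b₂) (λ h b₁ b₂ → h (b₁ , b₂))
                    (∀-Bool? λ b₁ → ∀-Bool? λ b₂ → P? (b₁ , b₂))

_≟ᶜ_ : (c d : Colour) → Dec (c ≡ d)
_≟ᶜ_ = ≡-dec Bool._≟_ Bool._≟_

blocks-are-permutations : ∀ c a → inBlock c a 5 ≡ 1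
blocks-are-permutations = toWitness {a? = ∀-Colour? λ c → all? λ a → inBlock c a 5 ≟ 1} tt

xw-permutationBlocks : PermutationBlocks xw
xw-permutationBlocks a q = trans (xw-block a q 5 ≤-refl) (blocks-are-permutations (colour q) a)

xw-window : ∀ a j N t → t ≤ 5 → count a xw (j * 5) (N * 5 + t) ≡ N + inBlock (colour (j + N)) a t
xw-window a j N t t≤5 =
  trans (window j N t) (cong (N +_) (xw-block a (j + N) t t≤5))
  where open PermutationBlockCounts xw xw-permutationBlocks a

-- For an Abelian square u v of length |u| = m = r + 5M starting at 5j + 1,
-- the prefixes from 5j of lengths 1 + m and 1 + 2m end t₁ r, resp. t₂ r,
-- letters into blocks j + M, resp. j + 2M + δ r.
t₁ t₂ δ : Fin 5 → ℕ
t₁ r = suc (toℕ r)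
t₂ r = suc (toℕ r + toℕ r) % 5
δ  r = suc (toℕ r + toℕ r) / 5

-- The equation that such a square imposes on the three block colours.
SquareProfile : Fin 5 → Colour → Colour → Colour → Set
SquareProfile r c₀ c₁ c₂ = (a : Fin 5) →
  δ r + inBlock c₂ a (t₂ r) + inBlock c₀ a 1 ≡ inBlock c₁ a (t₁ r) + inBlock c₁ a (t₁ r)

squareProfile? : ∀ r c₀ c₁ c₂ → Dec (SquareProfile r c₀ c₁ c₂)
squareProfile? r c₀ c₁ c₂ = all? λ a →
  δ r + inBlock c₂ a (t₂ r) + inBlock c₀ a 1 ≟ inBlock c₁ a (t₁ r) + inBlock c₁ a (t₁ r)

-- The only solutions have length divisible by 5 and three equal colours.
-- It is kept opaque so that the evaluated proof is never unfolded at its uses.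
opaque
  square-profile-check : ∀ r c₀ c₁ c₂ → SquareProfile r c₀ c₁ c₂ → r ≡ Fin.zero × c₁ ≡ c₀ × c₂ ≡ c₀
  square-profile-check = toWitness {a? = all? λ r → ∀-Colour? λ c₀ → ∀-Colour? λ c₁ → ∀-Colour? λ c₂ →
    squareProfile? r c₀ c₁ c₂ →-dec (r ≟ᶠ Fin.zero ×-dec (c₁ ≟ᶜ c₀ ×-dec c₂ ≟ᶜ c₀))} tt

-- Comparing the letter counts of the prefixes from 5j of lengths 1, 1 + m and
-- 1 + 2m, and cancelling the 2M whole blocks, yields the profile equation.
square⇒profile : ∀ j r M → let m = toℕ r + M * 5 in AbEq xw (j * 5 + 1) (j * 5 + 1 + m) m →
  SquareProfile r (colour j) (colour (j + M)) (colour (j + (δ r + (M + M))))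
square⇒profile j r M square a = +-cancelˡ-≡ (M + M) _ _ (begin
  (M + M) + (δ r + P₂ + P₀)              ≡⟨ regroup (M + M) (δ r) P₂ P₀ ⟩
  (N₂ + P₂) + P₀                         ≡⟨ sym (cong₂ _+_ prefix₂ prefix₀) ⟩
  count a xw (j * 5) (1 + m + m) + count a xw (j * 5) 1
                                         ≡⟨ square-prefixCounts a xw (j * 5) 1 m square ⟩
  count a xw (j * 5) (1 + m) + count a xw (j * 5) (1 + m)
                                         ≡⟨ cong₂ _+_ prefix₁ prefix₁ ⟩
  (M + P₁) + (M + P₁)                    ≡⟨ interleave M P₁ ⟩
  (M + M) + (P₁ + P₁)                    ∎)
  where
  open ≡-Reasoning
  m : ℕ
  m  = toℕ r + M * 5
  N₂ : ℕ
  N₂ = δ r + (M + M)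
  P₀ : ℕ
  P₀ = inBlock (colour j) a 1
  P₁ : ℕ
  P₁ = inBlock (colour (j + M)) a (t₁ r)
  P₂ : ℕ
  P₂ = inBlock (colour (j + N₂)) a (t₂ r)
  regroup : ∀ N d p q → N + (d + p + q) ≡ d + N + p + q
  regroup = solve-∀
  interleave : ∀ M p → M + p + (M + p) ≡ M + M + (p + p)
  interleave = solve-∀
  length₁ : 1 + m ≡ M * 5 + t₁ r
  length₁ = trans (cong suc (+-comm (toℕ r) (M * 5))) (sym (+-suc (M * 5) (toℕ r)))
  length₂ : 1 + m + m ≡ N₂ * 5 + t₂ r
  length₂ = begin
    1 + m + m                                          ≡⟨ double-residue (toℕ r) M ⟩
    suc (toℕ r + toℕ r) + (M + M) * 5                  ≡⟨ cong (_+ (M + M) * 5) (m≡m%n+[m/n]*n (suc (toℕ r + toℕ r)) 5) ⟩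
    t₂ r + δ r * 5 + (M + M) * 5                       ≡⟨ collect (t₂ r) (δ r) M ⟩
    N₂ * 5 + t₂ r                                      ∎
    where
    double-residue : ∀ r M → suc (r + M * 5 + (r + M * 5)) ≡ suc (r + r) + (M + M) * 5
    double-residue = solve-∀
    collect : ∀ t d M → t + d * 5 + (M + M) * 5 ≡ (d + (M + M)) * 5 + t
    collect = solve-∀
  prefix₀ : count a xw (j * 5) 1 ≡ P₀
  prefix₀ = xw-block a j 1 (s≤s z≤n)
  prefix₁ : count a xw (j * 5) (1 + m) ≡ M + P₁
  prefix₁ = trans (cong (count a xw (j * 5)) length₁) (xw-window a j M (t₁ r) (toℕ<n r))
  prefix₂ : count a xw (j * 5) (1 + m + m) ≡ N₂ + P₂
  prefix₂ = trans (cong (count a xw (j * 5)) length₂) (xw-window a j N₂ (t₂ r) (<⇒≤ (m%n<n (suc (toℕ r + toℕ r)) 5)))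

noAbelianSquareAt : ∀ j → StartsNoMonochromaticAP j → NoAbelianSquareAt xw (j * 5 + 1)
noAbelianSquareAt j noAP m 1≤m square with m divMod 5
... | result M r refl
  with square-profile-check r (colour j) (colour (j + M)) (colour (j + (δ r + (M + M))))
                            (square⇒profile j r M square)
... | refl , same₁ , same₂ = noAP M (positive M 1≤m) same₁ same₂
  where
  positive : ∀ M → 1 ≤ M * 5 → 1 ≤ M
  positive zero    ()
  positive (suc M) _ = s≤s z≤n

n<3^n : ∀ n → n < 3 ^ n
n<3^n zero    = s≤s z≤n
n<3^n (suc n) = begin-strict
  suc n          ≤⟨ n<3^n n ⟩
  3 ^ n          <⟨ m<m*n (3 ^ n) 3 {{m^n≢0 3 n}} (s≤s (s≤s z≤n)) ⟩
  3 ^ n * 3      ≡⟨ *-comm (3 ^ n) 3 ⟩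
  3 ^ suc n      ∎
  where open ≤-Reasoning

-- The numbers 9t + 4, whose two lowest ternary digits are 1.
periodMultiplier : ℕ → ℕ
periodMultiplier t = suc (suc (t * 3) * 3)

periodMultiplier-colour : ∀ t → colour (periodMultiplier t) ≡ (false , false)
periodMultiplier-colour t = trans (colour-3q+1 (suc (t * 3))) (cong (false ,_) (lowDigitTwo-3q+1 t))

-- A factor of length n at position i reoccurs at all positions
-- i + (9t + 4) · 3^(i+n) · 5, since the blocks it meets have indices below
-- 3^(i+n) and the colouring is invariant under these shifts.
xw-recurrent : RecurrentAlongProgressions xw
xw-recurrent i n = i + 4 * p * 5 , 9 * p * 5 , L≢0 , occurrence
  where
  p : ℕ
  p = 3 ^ (i + n)
  L≢0 : NonZero (9 * p * 5)
  L≢0 = m*n≢0 (9 * p) 5 {{m*n≢0 9 p {{_}} {{m^n≢0 3 (i + n)}}}}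
  occurrence : ∀ t → FactorEq xw i (i + 4 * p * 5 + t * (9 * p * 5)) n
  occurrence t t′ t′<n = sym (begin
    xw (i + 4 * p * 5 + t * (9 * p * 5) + t′)        ≡⟨ cong xw (position i t′ t p) ⟩
    xw (i + t′ + periodMultiplier t * p * 5)         ≡⟨ xw-shift (i + t′) (periodMultiplier t * p) ⟩
    blockWord (colour ((i + t′) / 5 + periodMultiplier t * p)) (i + t′)
      ≡⟨ cong (λ c → blockWord c (i + t′)) (colour-periodic (periodMultiplier t) (periodMultiplier-colour t)
                                              (i + n) ((i + t′) / 5) block<p) ⟩
    xw (i + t′)                                      ∎)
    where
    open ≡-Reasoning
    position : ∀ i t′ t p → i + 4 * p * 5 + t * (9 * p * 5) + t′ ≡ i + t′ + suc (suc (t * 3) * 3) * p * 5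
    position = solve-∀
    block<p : (i + t′) / 5 < p
    block<p = ≤-<-trans (m/n≤m (i + t′) 5) (<-trans (+-monoʳ-< i t′<n) (n<3^n (i + n)))

mainTheorem6 : Σ ℕ λ k → Σ (Word k) λ x →
    UniformlyRecurrent x × BoundedAbelianComplexity x × InfinitelyManyNoAbSqPositions x
mainTheorem6 = 5 , xw , uniformlyRecurrent , boundedAbelianComplexity , infinitelyManySquareFree
  where
  uniformlyRecurrent : UniformlyRecurrent xw
  uniformlyRecurrent = recurrentAlongProgressions⇒uniformlyRecurrent xw xw-recurrent
  boundedAbelianComplexity : BoundedAbelianComplexity xw
  boundedAbelianComplexity =
    balanced⇒boundedAbelianComplexity 5 xw (permutationBlocks⇒balanced xw xw-permutationBlocks)
  infinitelyManySquareFree : InfinitelyManyNoAbSqPositions xw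
  infinitelyManySquareFree N = 3 ^ N * 5 + 1 , N≤ ,
    noAbelianSquareAt (3 ^ N) (startsNoMonochromaticAP-3^ N)
    where
    N≤ : N ≤ 3 ^ N * 5 + 1
    N≤ = ≤-trans (<⇒≤ (n<3^n N)) (≤-trans (m≤m*n (3 ^ N) 5) (m≤m+n (3 ^ N * 5) 1))
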